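{- Let $n\ge 2$. For $v\in V_{n,3}$ let $\langle v,v_S\rangle$ denote the coefficient of $v_S$ in the expansion of $v$ in the basis $\{v_S: S\in\binom{[2n-1]}{n}\}$. Then for all $S,T\in\binom{[2n-1]}{n}$, $\langle\varphi(v_S),v_T\rangle=1$ if $S=T$; $=(-1)^d$ if $S\cap T=\{d\}$; and $=0$ if $S\ne T$ and $|S\cap T|>1$.
   Context: Over $\mathbb{C}$. Let $V_{n,3}$ be the vector space spanned by $[[\tau_1,\dots,\tau_n],\tau_{n+1},\dots,\tau_{2n-1}]$, $\tau\in S_{2n-1}$, where $[\cdot,\dots,\cdot]$ is a formal $n$-linear bracket subject only to antisymmetry $[x_1,\dots,x_n]=\mathrm{sgn}(\sigma)[x_{\sigma(1)},\dots,x_{\sigma(n)}]$. For an $n$-subset $S=\{a_1<\dots<a_n\}$ of $[2n-1]$ with complement $\{b_1<\dots<b_{n-1}\}$, $v_S=[[a_1,\dots,a_n],b_1,\dots,b_{n-1}]$; these form a basis of $V_{n,3}$. $R_S=v_S-\sum_{i=1}^n[a_1,\dots,a_{i-1},[a_i,b_1,\dots,b_{n-1}],a_{i+1},\dots,a_n]$, and $\varphi:V_{n,3}\to V_{n,3}$ is the linear map with $\varphi(v_S)=R_S$. -}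

module Defs where

open import Data.Bool using (Bool; true; false; if_then_else_; _∧_; not)
import Data.Bool as B
open import Data.Nat using (ℕ; zero; suc; _+_; _*_; _∸_; _<ᵇ_)
open import Data.Fin using (Fin; toℕ)
import Data.Fin as F
open import Data.Fin.Subset using (Subset; ⁅_⁆; _∪_; ∁; ⊥)
open import Data.Fin.Subset.Properties using (_∈?_)
open import Data.List using (List; []; _∷_; _++_; length; filter; filterᵇ; allFin; foldr; map)
open import Data.Product using (_×_; _,_)
open import Data.Integer using (ℤ; 0ℤ; 1ℤ; -_) renaming (_*_ to _*ℤ_; _+_ to _+ℤ_)
open import Data.Vec.Properties using (≡-dec)
open import Relation.Nullary using (does)
open import Data.Bool.ListAction using (any)

-- Labels 1,…,2n-1 of the paper are represented by Fin (2n-1): label k ↔ index k-1.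
-- Coefficients: all coefficients occurring are integers, so formal sums are
-- taken with ℤ coefficients (ℤ ⊂ ℂ).

neg1^ : ℕ → ℤ
neg1^ zero    = 1ℤ
neg1^ (suc k) = - neg1^ k

module _ {m : ℕ} where

  elems : Subset m → List (Fin m)
  elems S = filter (_∈? S) (allFin m)

  toSubset : List (Fin m) → Subset m
  toSubset = foldr (λ x A → ⁅ x ⁆ ∪ A) ⊥

  inv : List (Fin m) → ℕ
  inv []       = 0
  inv (x ∷ xs) = length (filterᵇ (λ y → toℕ y <ᵇ toℕ x) xs) + inv xs

  distinct : List (Fin m) → Bool
  distinct []       = true
  distinct (x ∷ xs) = not (any (λ y → does (x F.≟ y)) xs) ∧ distinct xs

  -- sign of the permutation sorting a list (0 if a label repeats, by antisymmetry)
  sgn : List (Fin m) → ℤ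
  sgn xs = if distinct xs then neg1^ (inv xs) else 0ℤ

  -- A raw spanning term of V_{n,3}: an outer n-bracket whose arguments are the
  -- labels 'outer' (in order) with the inner bracket [inner] inserted at
  -- (0-based) position 'pos'.
  record Term : Set where
    constructor term
    field
      pos   : ℕ
      inner : List (Fin m)
      outer : List (Fin m)

  FormalSum : Set
  FormalSum = List (ℤ × Term)

  -- coefficient of the basis vector v_T in a single term, obtained by
  -- normalising via antisymmetry: move the inner bracket to the front
  -- (sign (-1)^pos), sort the inner labels and the outer labels.
  termCoeff : Term → Subset m → ℤ
  termCoeff (term p i o) T =
    if does (≡-dec B._≟_ (toSubset i) T) ∧ does (≡-dec B._≟_ (toSubset o) (∁ T))
    then neg1^ p *ℤ sgn i *ℤ sgn o
    else 0ℤ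

  coeff : FormalSum → Subset m → ℤ
  coeff []             T = 0ℤ
  coeff ((c , t) ∷ xs) T = c *ℤ termCoeff t T +ℤ coeff xs T

  splits : List (Fin m) → List (List (Fin m) × Fin m × List (Fin m))
  splits []       = []
  splits (x ∷ xs) = ([] , x , xs) ∷ map (λ { (p , y , s) → (x ∷ p , y , s) }) (splits xs)

  vS : Subset m → Term
  vS S = term 0 (elems S) (elems (∁ S))

  -- φ(v_S) = R_S = v_S - Σ_i [a_1,…,a_{i-1},[a_i,b_1,…,b_{n-1}],a_{i+1},…,a_n]
  φv : Subset m → FormalSum
  φv S = (1ℤ , vS S)
       ∷ map (λ { (p , a , s) → (- 1ℤ , term (length p) (a ∷ elems (∁ S)) (p ++ s)) })
             (splits (elems S))

module Submission where

-- Write C = elems (∁ S) for the increasing list of the n-1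
-- labels outside S.  By definition φ(v_S) = v_S - Σ_{splits} t(p,a,s), one
-- term for every way of writing elems S = p ++ a ∷ s, namely
-- t(p,a,s) = [p ; [a ∷ C] inserted at position |p| ; s].  Reading off the
-- coefficient of v_T from a term only needs the sets of inner and outer
-- labels: t(p,a,s) contributes only if ⁅ a ⁆ ∪ ∁ S = T, and then with sign
-- -(-1)^|p| · sgn (a ∷ C), because the lists p ++ s and C are increasing.
--   * S = T:  ∁ S is nonempty (n ≥ 2), so no split contributes; only v_S does.
--   * 1 < ∣S ∩ T∣:  ⁅ a ⁆ ∪ ∁ S = T forces S ∩ T ⊆ ⁅ a ⁆, so again no split
--     contributes, and v_S does not either since S ≠ T.
--   * S ∩ T = ⁅ d ⁆:  a cardinality count gives ⁅ d ⁆ ∪ ∁ S = T, and d is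
--     the only label of S for which this holds, so exactly the split at d
--     contributes.  Its sign is -(-1)^(r + r'), where r and r' count the
--     labels below d in S and outside S respectively; r + r' = d.

open import Defs
open import Data.Bool using (true; false; if_then_else_; _∧_; not)
import Data.Bool as Bool
open import Data.Nat using (ℕ; zero; suc; _+_; _*_; _∸_; _<ᵇ_; _≤_; _<_; s≤s; z≤n)
open import Data.Nat.Properties
open import Data.Fin using (Fin; toℕ) renaming (zero to fzero; suc to fsuc)
import Data.Fin as F
import Data.Fin.Properties as FP
open import Data.Fin.Subset using (Subset; ⁅_⁆; _∪_; ∁; _∈_; _⊆_; ∣_∣; _∩_; Nonempty; inside; outside)
open import Data.Fin.Subset.Properties
open import Data.List using (List; []; _∷_; _++_; length; filter; filterᵇ; allFin; map)
open import Data.List.Properties using (map-tabulate; filter-++; filter-all; filter-none; length-++)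
open import Data.List.Relation.Unary.All using (All; []; _∷_)
import Data.List.Relation.Unary.All as All
import Data.List.Relation.Unary.All.Properties as AllP
open import Data.List.Relation.Unary.Any using (here; there)
open import Data.List.Relation.Unary.AllPairs using (AllPairs; []; _∷_)
import Data.List.Relation.Unary.AllPairs.Properties as AllPairsP
import Data.List.Membership.Propositional as Mem
open import Data.List.Membership.Propositional.Properties using (∈-filter⁺; ∈-filter⁻; ∈-allFin; ∈-++⁻; ∈-++⁺ˡ; ∈-++⁺ʳ; ∈-∃++)
open import Data.Product using (_×_; _,_; proj₁; proj₂)
open import Data.Sum using (inj₁; inj₂)
open import Function using (_∘_; case_of_)
open import Data.Empty using (⊥-elim)
open import Data.Integer using (ℤ; 0ℤ; 1ℤ; -_) renaming (_*_ to _*ℤ_; _+_ to _+ℤ_)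
import Data.Integer.Properties as ℤP
import Data.Vec as Vec
open import Data.Vec.Properties using (≡-dec)
open import Relation.Nullary using (does; yes; no; ¬_)
open import Relation.Binary.PropositionalEquality
open import Data.Bool.ListAction using (any)

_∈ₗ_ : ∀ {m} → Fin m → List (Fin m) → Set
x ∈ₗ xs = x Mem.∈ xs

neg1^-+ : ∀ a b → neg1^ (a + b) ≡ neg1^ a *ℤ neg1^ b
neg1^-+ zero    b = sym (ℤP.*-identityˡ (neg1^ b))
neg1^-+ (suc a) b = trans (cong -_ (neg1^-+ a b)) (ℤP.neg-distribˡ-* (neg1^ a) (neg1^ b))

Increasing : ∀ {m} → List (Fin m) → Set
Increasing = AllPairs F._<_

module _ {m : ℕ} where

  elems-increasing : (S : Subset m) → Increasing (elems S)
  elems-increasing S = AllPairsP.filter⁺ (_∈? S) (AllPairsP.tabulate⁺-< (λ i<j → i<j))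

  below : Fin m → List (Fin m) → ℕ
  below d xs = length (filterᵇ (λ y → toℕ y <ᵇ toℕ d) xs)

  below-none : ∀ (d : Fin m) {xs} → All (d F.≤_) xs → below d xs ≡ 0
  below-none d ds = cong length (filter-none _ (All.map (λ d≤y y<d → <⇒≱ (<ᵇ⇒< _ _ y<d) d≤y) ds))

  below-all : ∀ (d : Fin m) {xs} → All (F._< d) xs → below d xs ≡ length xs
  below-all d ds = cong length (filter-all _ (All.map <⇒<ᵇ ds))

  below-++ : ∀ (d : Fin m) xs ys → below d (xs ++ ys) ≡ below d xs + below d ys
  below-++ d xs ys = trans (cong length (filter-++ _ xs ys)) (length-++ (filterᵇ _ xs))

  no-duplicate : ∀ (x : Fin m) xs → ¬ (x ∈ₗ xs) → any (λ y → does (x F.≟ y)) xs ≡ false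
  no-duplicate x []       _  = refl
  no-duplicate x (y ∷ ys) x∉ with x F.≟ y
  ... | yes refl = ⊥-elim (x∉ (here refl))
  ... | no _     = no-duplicate x ys (λ x∈ → x∉ (there x∈))

  head-not-repeated : ∀ {x : Fin m} {xs} → All (x F.<_) xs → ¬ (x ∈ₗ xs)
  head-not-repeated x<xs x∈ = <-irrefl refl (All.lookup x<xs x∈)

  increasing-distinct : ∀ {xs : List (Fin m)} → Increasing xs → distinct xs ≡ true
  increasing-distinct {[]}     []          = refl
  increasing-distinct {x ∷ xs} (x<xs ∷ inc)
    rewrite no-duplicate x xs (head-not-repeated x<xs) = increasing-distinct inc

  increasing-inv : ∀ {xs : List (Fin m)} → Increasing xs → inv xs ≡ 0
  increasing-inv {[]}     []          = refl
  increasing-inv {x ∷ xs} (x<xs ∷ inc) = cong₂ _+_ (below-none x (All.map <⇒≤ x<xs)) (increasing-inv inc)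

  increasing-sgn : ∀ {xs : List (Fin m)} → Increasing xs → sgn xs ≡ 1ℤ
  increasing-sgn inc =
    cong₂ (λ b k → if b then neg1^ k else 0ℤ) (increasing-distinct inc) (increasing-inv inc)

  sgn-cons : ∀ (d : Fin m) {xs} → ¬ (d ∈ₗ xs) → Increasing xs → sgn (d ∷ xs) ≡ neg1^ (below d xs)
  sgn-cons d {xs} d∉ inc = trans
    (cong₂ (λ b k → if not b ∧ distinct xs then neg1^ (below d xs + k) else 0ℤ)
           (no-duplicate d xs d∉) (increasing-inv inc))
    (cong₂ (λ b k → if b then neg1^ k else 0ℤ)
           (increasing-distinct inc) (+-identityʳ (below d xs)))

  increasing-delete : ∀ (p : List (Fin m)) d s → Increasing (p ++ d ∷ s) →
    Increasing (p ++ s) × All (F._< d) p × All (d F.<_) s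
  increasing-delete []      d s (d<s ∷ inc) = inc , [] , d<s
  increasing-delete (x ∷ p) d s (x<rest ∷ inc) with increasing-delete p d s inc
  ... | inc′ , p<d , d<s with AllP.++⁻ p x<rest
  ...   | x<p , x<d ∷ x<s = (AllP.++⁺ x<p x<s ∷ inc′) , x<d ∷ p<d , d<s

  increasing-once : ∀ (p : List (Fin m)) d s → Increasing (p ++ d ∷ s) → All (_≢ d) p × All (_≢ d) s
  increasing-once p d s inc with increasing-delete p d s inc
  ... | _ , p<d , d<s = All.map FP.<⇒≢ p<d , All.map (λ d<y → FP.<⇒≢ d<y ∘ sym) d<s

module _ {m : ℕ} where

  toSubset-∈⁺ : ∀ {x : Fin m} xs → x ∈ₗ xs → x ∈ toSubset xs
  toSubset-∈⁺ (y ∷ xs) (here refl) = x∈p∪q⁺ (inj₁ (x∈⁅x⁆ y))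
  toSubset-∈⁺ (y ∷ xs) (there x∈) = x∈p∪q⁺ (inj₂ (toSubset-∈⁺ xs x∈))

  toSubset-∈⁻ : ∀ {x : Fin m} xs → x ∈ toSubset xs → x ∈ₗ xs
  toSubset-∈⁻ []       x∈ = ⊥-elim (∉⊥ x∈)
  toSubset-∈⁻ (y ∷ xs) x∈ with x∈p∪q⁻ ⁅ y ⁆ (toSubset xs) x∈
  ... | inj₁ x∈y  = here (x∈⁅y⁆⇒x≡y y x∈y)
  ... | inj₂ x∈xs = there (toSubset-∈⁻ xs x∈xs)

  elems-∈⁺ : ∀ {x : Fin m} (S : Subset m) → x ∈ S → x ∈ₗ elems S
  elems-∈⁺ {x} S x∈S = ∈-filter⁺ (_∈? S) (∈-allFin x) x∈S

  elems-∈⁻ : ∀ {x : Fin m} (S : Subset m) → x ∈ₗ elems S → x ∈ S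
  elems-∈⁻ S x∈ = proj₂ (∈-filter⁻ (_∈? S) {xs = allFin m} x∈)

  toSubset-elems : (S : Subset m) → toSubset (elems S) ≡ S
  toSubset-elems S = ⊆-antisym (λ x∈ → elems-∈⁻ S (toSubset-∈⁻ (elems S) x∈))
                               (λ x∈ → toSubset-∈⁺ (elems S) (elems-∈⁺ S x∈))

  below-partition : ∀ (d : Fin m) (S : Subset m) xs →
    below d (filter (_∈? S) xs) + below d (filter (_∈? ∁ S) xs) ≡ below d xs
  below-partition d S []       = refl
  below-partition d S (x ∷ xs) with x ∈? S | x ∈? ∁ S
  ... | yes x∈S | yes x∈∁S = ⊥-elim (x∈∁p⇒x∉p x∈∁S x∈S)
  ... | no  x∉S | no  x∉∁S = ⊥-elim (x∉∁S (x∉p⇒x∈∁p x∉S))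
  ... | yes _   | no  _ with toℕ x <ᵇ toℕ d
  ...   | true  = cong suc (below-partition d S xs)
  ...   | false = below-partition d S xs
  below-partition d S (x ∷ xs) | no _ | yes _ with toℕ x <ᵇ toℕ d
  ...   | true  = trans (+-suc _ _) (cong suc (below-partition d S xs))
  ...   | false = below-partition d S xs

  below-at : ∀ (p : List (Fin m)) d s → Increasing (p ++ d ∷ s) → below d (p ++ d ∷ s) ≡ length p
  below-at p d s inc with increasing-delete p d s inc
  ... | _ , p<d , d<s = begin
    below d (p ++ d ∷ s)         ≡⟨ below-++ d p (d ∷ s) ⟩
    below d p + below d (d ∷ s)  ≡⟨ cong₂ _+_ (below-all d p<d) (below-none d (≤-refl ∷ All.map <⇒≤ d<s)) ⟩
    length p + 0                 ≡⟨ +-identityʳ (length p) ⟩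
    length p                     ∎
    where open ≡-Reasoning

below-fsuc : ∀ {m} (d : Fin m) xs → below (fsuc d) (map fsuc xs) ≡ below d xs
below-fsuc d []       = refl
below-fsuc d (x ∷ xs) with toℕ x <ᵇ toℕ d
... | true  = cong suc (below-fsuc d xs)
... | false = below-fsuc d xs

below-allFin : ∀ m (d : Fin m) → below d (allFin m) ≡ toℕ d
below-allFin (suc m) fzero    = below-none fzero {allFin (suc m)} (AllP.tabulate⁺ {f = λ x → x} (λ _ → z≤n))
below-allFin (suc m) (fsuc d) = begin
  below (fsuc d) (allFin (suc m))                  ≡⟨ cong (below (fsuc d) ∘ (fzero ∷_)) (sym (map-tabulate (λ x → x) fsuc)) ⟩
  suc (below (fsuc d) (map fsuc (allFin m)))       ≡⟨ cong suc (below-fsuc d (allFin m)) ⟩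
  suc (below d (allFin m))                         ≡⟨ cong suc (below-allFin m d) ⟩
  suc (toℕ d)                                      ∎
  where open ≡-Reasoning

below-labels : ∀ {m} (d : Fin m) (S : Subset m) → below d (elems S) + below d (elems (∁ S)) ≡ toℕ d
below-labels {m} d S = trans (below-partition d S (allFin m)) (below-allFin m d)

ΣL : ∀ {A : Set} → (A → ℤ) → List A → ℤ
ΣL h []       = 0ℤ
ΣL h (z ∷ zs) = h z +ℤ ΣL h zs

ΣL-map : ∀ {A B : Set} (h : B → ℤ) (k : A → B) xs → ΣL h (map k xs) ≡ ΣL (h ∘ k) xs
ΣL-map h k []       = refl
ΣL-map h k (x ∷ xs) = cong (h (k x) +ℤ_) (ΣL-map h k xs)

ΣL-vanish : ∀ {A : Set} (h : A → ℤ) {xs} → All (λ z → h z ≡ 0ℤ) xs → ΣL h xs ≡ 0ℤ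
ΣL-vanish h []            = refl
ΣL-vanish h (hz≡0 ∷ rest) = cong₂ _+ℤ_ hz≡0 (ΣL-vanish h rest)

module _ {m : ℕ} where

  coeff-map : ∀ {A : Set} (F : A → ℤ × Term {m}) xs (T : Subset m) →
    coeff (map F xs) T ≡ ΣL (λ z → proj₁ (F z) *ℤ termCoeff (proj₂ (F z)) T) xs
  coeff-map F []       T = refl
  coeff-map F (x ∷ xs) T = cong (proj₁ (F x) *ℤ termCoeff (proj₂ (F x)) T +ℤ_) (coeff-map F xs T)

  termCoeff-mismatch : ∀ q (i o : List (Fin m)) T → toSubset i ≢ T → termCoeff (term q i o) T ≡ 0ℤ
  termCoeff-mismatch q i o T i≢T with ≡-dec Bool._≟_ (toSubset i) T
  ... | yes i≡T = ⊥-elim (i≢T i≡T)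
  ... | no  _   = refl

  termCoeff-match : ∀ q (i o : List (Fin m)) T → toSubset i ≡ T → toSubset o ≡ ∁ T →
    termCoeff (term q i o) T ≡ neg1^ q *ℤ sgn i *ℤ sgn o
  termCoeff-match q i o T i≡T o≡∁T with ≡-dec Bool._≟_ (toSubset i) T | ≡-dec Bool._≟_ (toSubset o) (∁ T)
  ... | yes _   | yes _    = refl
  ... | no i≢T  | _        = ⊥-elim (i≢T i≡T)
  ... | yes _   | no o≢∁T  = ⊥-elim (o≢∁T o≡∁T)

  vS-diagonal : (S : Subset m) → termCoeff (vS S) S ≡ 1ℤ
  vS-diagonal S = begin
    termCoeff (vS S) S                              ≡⟨ termCoeff-match 0 (elems S) (elems (∁ S)) S (toSubset-elems S) (toSubset-elems (∁ S)) ⟩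
    1ℤ *ℤ sgn (elems S) *ℤ sgn (elems (∁ S))        ≡⟨ cong₂ (λ a b → 1ℤ *ℤ a *ℤ b) (increasing-sgn (elems-increasing S)) (increasing-sgn (elems-increasing (∁ S))) ⟩
    1ℤ                                              ∎
    where open ≡-Reasoning

  vS-offdiagonal : {S T : Subset m} → S ≢ T → termCoeff (vS S) T ≡ 0ℤ
  vS-offdiagonal {S} {T} S≢T =
    termCoeff-mismatch 0 (elems S) (elems (∁ S)) T (λ e → S≢T (trans (sym (toSubset-elems S)) e))

  Split : Set
  Split = List (Fin m) × Fin m × List (Fin m)

  pivot : Split → Fin m
  pivot (_ , a , _) = a

  splitCoeff : (S T : Subset m) → Split → ℤ
  splitCoeff S T (p , a , s) = - 1ℤ *ℤ termCoeff (term (length p) (a ∷ elems (∁ S)) (p ++ s)) T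

  coeff-φv : (S T : Subset m) →
    coeff (φv S) T ≡ termCoeff (vS S) T +ℤ ΣL (splitCoeff S T) (splits (elems S))
  coeff-φv S T = cong₂ _+ℤ_ (ℤP.*-identityˡ (termCoeff (vS S) T)) (coeff-map _ (splits (elems S)) T)

  -- The inner labels of a split with pivot a form ⁅ a ⁆ ∪ ∁ S.
  splitCoeff-vanish : (S T : Subset m) → ∀ z → ⁅ pivot z ⁆ ∪ ∁ S ≢ T → splitCoeff S T z ≡ 0ℤ
  splitCoeff-vanish S T (p , a , s) a∪∁S≢T =
    cong (- 1ℤ *ℤ_) (termCoeff-mismatch (length p) (a ∷ elems (∁ S)) (p ++ s) T
                      (λ e → a∪∁S≢T (trans (cong (⁅ a ⁆ ∪_) (sym (toSubset-elems (∁ S)))) e)))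

  splits-pivot : ∀ xs → All (λ z → pivot z ∈ₗ xs) (splits xs)
  splits-pivot []       = []
  splits-pivot (x ∷ xs) = here refl ∷ AllP.map⁺ (All.map there (splits-pivot xs))

  sum-splits-single : (h : Split → ℤ) → ∀ p d s → All (_≢ d) p → All (_≢ d) s →
    (∀ z → pivot z ∈ₗ (p ++ d ∷ s) → pivot z ≢ d → h z ≡ 0ℤ) →
    ΣL h (splits (p ++ d ∷ s)) ≡ h (p , d , s)
  sum-splits-single h [] d s _ s≢d vanish = begin
    h ([] , d , s) +ℤ ΣL h (map _ (splits s))      ≡⟨ cong (h ([] , d , s) +ℤ_) (ΣL-map h _ (splits s)) ⟩
    h ([] , d , s) +ℤ ΣL (h ∘ _) (splits s)        ≡⟨ cong (h ([] , d , s) +ℤ_) (ΣL-vanish _ (All.map later (splits-pivot s))) ⟩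
    h ([] , d , s) +ℤ 0ℤ                           ≡⟨ ℤP.+-identityʳ _ ⟩
    h ([] , d , s)                                 ∎
    where
    open ≡-Reasoning
    later : ∀ {z} → pivot z ∈ₗ s → h (d ∷ proj₁ z , proj₂ z) ≡ 0ℤ
    later {z} z∈s = vanish (d ∷ proj₁ z , proj₂ z) (there z∈s) (All.lookup s≢d z∈s)
  sum-splits-single h (x ∷ p) d s (x≢d ∷ p≢d) s≢d vanish = begin
    h ([] , x , p ++ d ∷ s) +ℤ ΣL h (map _ (splits (p ++ d ∷ s)))   ≡⟨ cong₂ _+ℤ_ (vanish _ (here refl) x≢d) (ΣL-map h _ (splits (p ++ d ∷ s))) ⟩
    0ℤ +ℤ ΣL h′ (splits (p ++ d ∷ s))                                ≡⟨ ℤP.+-identityˡ _ ⟩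
    ΣL h′ (splits (p ++ d ∷ s))                                      ≡⟨ sum-splits-single h′ p d s p≢d s≢d (λ z z∈ → vanish _ (there z∈)) ⟩
    h (x ∷ p , d , s)                                                ∎
    where
    open ≡-Reasoning
    h′ : Split → ℤ
    h′ (q , a , r) = h (x ∷ q , a , r)

∣p∪q∣≤∣p∣+∣q∣ : ∀ {m} (p q : Subset m) → ∣ p ∪ q ∣ ≤ ∣ p ∣ + ∣ q ∣
∣p∪q∣≤∣p∣+∣q∣ Vec.[]            Vec.[]            = z≤n
∣p∪q∣≤∣p∣+∣q∣ (outside Vec.∷ p) (outside Vec.∷ q) = ∣p∪q∣≤∣p∣+∣q∣ p q
∣p∪q∣≤∣p∣+∣q∣ (outside Vec.∷ p) (inside  Vec.∷ q) = ≤-trans (s≤s (∣p∪q∣≤∣p∣+∣q∣ p q)) (≤-reflexive (sym (+-suc ∣ p ∣ ∣ q ∣)))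
∣p∪q∣≤∣p∣+∣q∣ (inside  Vec.∷ p) (outside Vec.∷ q) = s≤s (∣p∪q∣≤∣p∣+∣q∣ p q)
∣p∪q∣≤∣p∣+∣q∣ (inside  Vec.∷ p) (inside  Vec.∷ q) = s≤s (≤-trans (∣p∪q∣≤∣p∣+∣q∣ p q) (+-monoʳ-≤ ∣ p ∣ (n≤1+n ∣ q ∣)))

module _ {m : ℕ} where

  size-nonempty : (p : Subset m) → 0 < ∣ p ∣ → Nonempty p
  size-nonempty p 0<∣p∣ with nonempty? p
  ... | yes ne = ne
  ... | no ¬ne = ⊥-elim (<-irrefl (sym (trans (cong ∣_∣ (Empty-unique ¬ne)) (∣⊥∣≡0 m))) 0<∣p∣)

  pivot-union-≢ : (S : Subset m) → Nonempty (∁ S) → ∀ a → ⁅ a ⁆ ∪ ∁ S ≢ S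
  pivot-union-≢ S (b , b∈∁S) a e = x∈∁p⇒x∉p b∈∁S (subst (b ∈_) e (x∈p∪q⁺ (inj₂ b∈∁S)))

  meet-⊆-pivot : (S T : Subset m) → ∀ a → ⁅ a ⁆ ∪ ∁ S ≡ T → S ∩ T ⊆ ⁅ a ⁆
  meet-⊆-pivot S T a e {x} x∈S∩T with x∈p∩q⁻ S T x∈S∩T
  ... | x∈S , x∈T with x∈p∪q⁻ ⁅ a ⁆ (∁ S) (subst (x ∈_) (sym e) x∈T)
  ...   | inj₁ x∈a  = x∈a
  ...   | inj₂ x∈∁S = ⊥-elim (x∈∁p⇒x∉p x∈∁S x∈S)

  -- Conversely, if S and T meet only in d and T is larger than ∁ S, then
  -- T = ⁅ d ⁆ ∪ ∁ S: T lies inside the right side, which is too small to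
  -- have room for anything else.
  fill-union : (S T : Subset m) → ∀ d → d ∈ T → S ∩ T ⊆ ⁅ d ⁆ → ∣ ∁ S ∣ < ∣ T ∣ → ⁅ d ⁆ ∪ ∁ S ≡ T
  fill-union S T d d∈T S∩T⊆d ∁S<T = ⊆-antisym union⊆T T⊆union
    where
    T⊆union : T ⊆ ⁅ d ⁆ ∪ ∁ S
    T⊆union {x} x∈T with x ∈? S
    ... | yes x∈S = x∈p∪q⁺ (inj₁ (S∩T⊆d (x∈p∩q⁺ (x∈S , x∈T))))
    ... | no  x∉S = x∈p∪q⁺ (inj₂ (x∉p⇒x∈∁p x∉S))

    union⊆T : ⁅ d ⁆ ∪ ∁ S ⊆ T
    union⊆T {x} x∈union with x ∈? T
    ... | yes x∈T = x∈T
    ... | no  x∉T = ⊥-elim (<-irrefl refl (begin-strict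
      ∣ T ∣                 <⟨ p⊂q⇒∣p∣<∣q∣ (T⊆union , x , x∈union , x∉T) ⟩
      ∣ ⁅ d ⁆ ∪ ∁ S ∣       ≤⟨ ∣p∪q∣≤∣p∣+∣q∣ ⁅ d ⁆ (∁ S) ⟩
      ∣ ⁅ d ⁆ ∣ + ∣ ∁ S ∣   ≡⟨ cong (_+ ∣ ∁ S ∣) (∣⁅x⁆∣≡1 d) ⟩
      suc ∣ ∁ S ∣           ≤⟨ ∁S<T ⟩
      ∣ T ∣                 ∎))
      where open ≤-Reasoning

  toSubset-delete : (S : Subset m) → ∀ p d s → elems S ≡ p ++ d ∷ s → All (_≢ d) (p ++ s) →
    toSubset (p ++ s) ≡ ∁ (⁅ d ⁆ ∪ ∁ S)
  toSubset-delete S p d s listing ≢d = ⊆-antisym into onto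
    where
    undelete : ∀ {x} → x ∈ₗ (p ++ s) → x ∈ₗ (p ++ d ∷ s)
    undelete x∈ with ∈-++⁻ p x∈
    ... | inj₁ x∈p = ∈-++⁺ˡ x∈p
    ... | inj₂ x∈s = ∈-++⁺ʳ p (there x∈s)

    into : toSubset (p ++ s) ⊆ ∁ (⁅ d ⁆ ∪ ∁ S)
    into {x} x∈ = x∉p⇒x∈∁p λ x∈union → case x∈p∪q⁻ ⁅ d ⁆ (∁ S) x∈union of λ where
        (inj₁ x∈d)  → All.lookup ≢d x∈ps (x∈⁅y⁆⇒x≡y d x∈d)
        (inj₂ x∈∁S) → x∈∁p⇒x∉p x∈∁S (elems-∈⁻ S (subst (x ∈ₗ_) (sym listing) (undelete x∈ps)))
      where x∈ps = toSubset-∈⁻ (p ++ s) x∈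

    in-S : ∀ {x} → x ∈ ∁ (⁅ d ⁆ ∪ ∁ S) → x ∈ S
    in-S x∈ = x∉∁p⇒x∈p (λ x∈∁S → x∈∁p⇒x∉p x∈ (x∈p∪q⁺ (inj₂ x∈∁S)))

    onto : ∁ (⁅ d ⁆ ∪ ∁ S) ⊆ toSubset (p ++ s)
    onto {x} x∈ with ∈-++⁻ p (subst (x ∈ₗ_) listing (elems-∈⁺ S (in-S x∈)))
    ... | inj₁ x∈p         = toSubset-∈⁺ (p ++ s) (∈-++⁺ˡ x∈p)
    ... | inj₂ (there x∈s) = toSubset-∈⁺ (p ++ s) (∈-++⁺ʳ p x∈s)
    ... | inj₂ (here refl) = ⊥-elim (x∈∁p⇒x∉p x∈ (x∈p∪q⁺ (inj₁ (x∈⁅x⁆ d))))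

module _ {m : ℕ} where

  coeff-φv-no-split : (S T : Subset m) → (∀ a → ⁅ a ⁆ ∪ ∁ S ≢ T) → coeff (φv S) T ≡ termCoeff (vS S) T
  coeff-φv-no-split S T none = begin
    coeff (φv S) T                                                ≡⟨ coeff-φv S T ⟩
    termCoeff (vS S) T +ℤ ΣL (splitCoeff S T) (splits (elems S))  ≡⟨ cong (termCoeff (vS S) T +ℤ_) (ΣL-vanish _ every-split-vanishes) ⟩
    termCoeff (vS S) T +ℤ 0ℤ                                      ≡⟨ ℤP.+-identityʳ _ ⟩
    termCoeff (vS S) T                                            ∎
    where
    open ≡-Reasoning
    every-split-vanishes : All (λ z → splitCoeff S T z ≡ 0ℤ) (splits (elems S))
    every-split-vanishes = All.tabulate (λ {z} _ → splitCoeff-vanish S T z (none (pivot z)))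

  -- The split of elems S = p ++ d ∷ s at d, measured against T = ⁅ d ⁆ ∪ ∁ S,
  -- contributes -(-1)^(|p| + #{labels of ∁ S below d}) = (-1)^(d+1).
  splitCoeff-at : (S : Subset m) → ∀ p d s → elems S ≡ p ++ d ∷ s →
    splitCoeff S (⁅ d ⁆ ∪ ∁ S) (p , d , s) ≡ neg1^ (suc (toℕ d))
  splitCoeff-at S p d s listing = begin
    - 1ℤ *ℤ termCoeff (term (length p) (d ∷ C) (p ++ s)) T     ≡⟨ cong (- 1ℤ *ℤ_) (termCoeff-match (length p) (d ∷ C) (p ++ s) T inner outer) ⟩
    - 1ℤ *ℤ (neg1^ (length p) *ℤ sgn (d ∷ C) *ℤ sgn (p ++ s))  ≡⟨ cong₂ (λ a b → - 1ℤ *ℤ (neg1^ (length p) *ℤ a *ℤ b)) (sgn-cons d d∉C (elems-increasing (∁ S))) (increasing-sgn (proj₁ (increasing-delete p d s sorted))) ⟩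
    - 1ℤ *ℤ (neg1^ (length p) *ℤ neg1^ (below d C) *ℤ 1ℤ)      ≡⟨ cong (- 1ℤ *ℤ_) (trans (ℤP.*-identityʳ _) (sym (neg1^-+ (length p) (below d C)))) ⟩
    - 1ℤ *ℤ neg1^ (length p + below d C)                       ≡⟨ ℤP.-1*i≡-i _ ⟩
    - neg1^ (length p + below d C)                             ≡⟨ cong (λ k → - neg1^ k) rank ⟩
    neg1^ (suc (toℕ d))                                        ∎
    where
    open ≡-Reasoning
    C : List (Fin m)
    C = elems (∁ S)
    T : Subset m
    T = ⁅ d ⁆ ∪ ∁ S

    sorted : Increasing (p ++ d ∷ s)
    sorted = subst Increasing listing (elems-increasing S)

    d∉C : ¬ (d ∈ₗ C)
    d∉C d∈C = x∈∁p⇒x∉p (elems-∈⁻ (∁ S) d∈C) (elems-∈⁻ S (subst (d ∈ₗ_) (sym listing) (∈-++⁺ʳ p (here refl))))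

    inner : toSubset (d ∷ C) ≡ T
    inner = cong (⁅ d ⁆ ∪_) (toSubset-elems (∁ S))

    outer : toSubset (p ++ s) ≡ ∁ T
    outer with increasing-once p d s sorted
    ... | p≢d , s≢d = toSubset-delete S p d s listing (AllP.++⁺ p≢d s≢d)

    rank : length p + below d C ≡ toℕ d
    rank = begin
      length p + below d C              ≡⟨ cong (_+ below d C) (sym (below-at p d s sorted)) ⟩
      below d (p ++ d ∷ s) + below d C  ≡⟨ cong (λ xs → below d xs + below d C) (sym listing) ⟩
      below d (elems S) + below d C     ≡⟨ below-labels d S ⟩
      toℕ d                             ∎

  coeff-φv-one-split : (S T : Subset m) → ∀ d → d ∈ S → S ≢ T → ⁅ d ⁆ ∪ ∁ S ≡ T →
    coeff (φv S) T ≡ neg1^ (suc (toℕ d))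
  coeff-φv-one-split S T d d∈S S≢T refl with ∈-∃++ (elems-∈⁺ S d∈S)
  ... | p , s , listing with increasing-once p d s (subst Increasing listing (elems-increasing S))
  ...   | p≢d , s≢d = begin
    coeff (φv S) T                                                  ≡⟨ coeff-φv S T ⟩
    termCoeff (vS S) T +ℤ ΣL (splitCoeff S T) (splits (elems S))    ≡⟨ cong₂ _+ℤ_ (vS-offdiagonal S≢T) (cong (ΣL (splitCoeff S T) ∘ splits) listing) ⟩
    0ℤ +ℤ ΣL (splitCoeff S T) (splits (p ++ d ∷ s))                 ≡⟨ ℤP.+-identityˡ _ ⟩
    ΣL (splitCoeff S T) (splits (p ++ d ∷ s))                       ≡⟨ sum-splits-single (splitCoeff S T) p d s p≢d s≢d other-pivots ⟩
    splitCoeff S T (p , d , s)                                      ≡⟨ splitCoeff-at S p d s listing ⟩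
    neg1^ (suc (toℕ d))                                             ∎
    where
    open ≡-Reasoning
    -- a pivot a ∈ S with ⁅ a ⁆ ∪ ∁ S = T lies in S ∩ T ⊆ ⁅ d ⁆
    other-pivots : ∀ z → pivot z ∈ₗ (p ++ d ∷ s) → pivot z ≢ d → splitCoeff S T z ≡ 0ℤ
    other-pivots z a∈ a≢d = splitCoeff-vanish S T z λ e → a≢d (x∈⁅y⁆⇒x≡y d
      (meet-⊆-pivot S T d refl (x∈p∩q⁺ (elems-∈⁻ S (subst (_ ∈ₗ_) (sym listing) a∈) ,
                                        subst (pivot z ∈_) e (x∈p∪q⁺ (inj₁ (x∈⁅x⁆ (pivot z))))))))

twice-minus : ∀ n → (2 * n ∸ 1) ∸ n ≡ n ∸ 1
twice-minus zero    = refl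
twice-minus (suc k) rewrite +-identityʳ k | +-suc k k = m+n∸m≡n k k

lemma2p3 : (n : ℕ) → 2 ≤ n → (S T : Subset (2 * n ∸ 1)) → ∣ S ∣ ≡ n → ∣ T ∣ ≡ n →
    (S ≡ T → coeff (φv S) T ≡ 1ℤ)
    × (∀ d → S ∩ T ≡ ⁅ d ⁆ → coeff (φv S) T ≡ neg1^ (suc (toℕ d)))
    × (S ≢ T → 1 < ∣ S ∩ T ∣ → coeff (φv S) T ≡ 0ℤ)
lemma2p3 n 2≤n S T ∣S∣≡n ∣T∣≡n = diagonal , single , crowded
  where
  ∣∁S∣≡n∸1 : ∣ ∁ S ∣ ≡ n ∸ 1
  ∣∁S∣≡n∸1 = trans (∣∁p∣≡n∸∣p∣ S) (trans (cong (2 * n ∸ 1 ∸_) ∣S∣≡n) (twice-minus n))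

  diagonal : S ≡ T → coeff (φv S) T ≡ 1ℤ
  diagonal refl = trans (coeff-φv-no-split S S (pivot-union-≢ S ∁S-nonempty)) (vS-diagonal S)
    where
    ∁S-nonempty : Nonempty (∁ S)
    ∁S-nonempty = size-nonempty (∁ S) (subst (0 <_) (sym ∣∁S∣≡n∸1) (m<n⇒0<n∸m 2≤n))

  single : ∀ d → S ∩ T ≡ ⁅ d ⁆ → coeff (φv S) T ≡ neg1^ (suc (toℕ d))
  single d S∩T≡d with x∈p∩q⁻ S T (subst (d ∈_) (sym S∩T≡d) (x∈⁅x⁆ d))
  ... | d∈S , d∈T = coeff-φv-one-split S T d d∈S S≢T (fill-union S T d d∈T (⊆-reflexive S∩T≡d) ∁S<T)
    where
    ∁S<T : ∣ ∁ S ∣ < ∣ T ∣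
    ∁S<T = subst₂ _<_ (sym ∣∁S∣≡n∸1) (sym ∣T∣≡n) (∸-monoʳ-< (s≤s z≤n) (≤-trans (s≤s z≤n) 2≤n))
    -- S = T would give ∣ S ∣ = ∣ S ∩ S ∣ = 1 < n
    S≢T : S ≢ T
    S≢T refl = <-irrefl (trans (sym (∣⁅x⁆∣≡1 d)) (trans (cong ∣_∣ (trans (sym S∩T≡d) (∩-idem S))) ∣S∣≡n)) 2≤n

  crowded : S ≢ T → 1 < ∣ S ∩ T ∣ → coeff (φv S) T ≡ 0ℤ
  crowded S≢T 1<∣S∩T∣ = trans (coeff-φv-no-split S T no-split) (vS-offdiagonal S≢T)
    where
    no-split : ∀ a → ⁅ a ⁆ ∪ ∁ S ≢ T
    no-split a e = <⇒≱ 1<∣S∩T∣ (≤-trans (p⊆q⇒∣p∣≤∣q∣ (meet-⊆-pivot S T a e)) (≤-reflexive (∣⁅x⁆∣≡1 a)))
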